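{- There exist connected graphs $G$ and $H$ such that $H$ is a spanning subgraph of $G$ and $src(G)>src(H)$. Similarly, there exist connected graphs $G$ and $H$ with $H$ a spanning subgraph of $G$ and $srvc(G)>srvc(H)$, and there exist connected graphs $G$ and $H$ with $H$ a spanning subgraph of $G$ and $strc(G)>strc(H)$.
   Context: All graphs are finite and simple; $u$–$v$ geodesic means a $u$–$v$ path of length $d(u,v)$. $src(G)$ is the minimum number of colours in an edge-colouring of $G$ in which any two vertices are joined by a geodesic whose edges have distinct colours. $srvc(G)$ is the minimum number of colours in a vertex-colouring in which any two vertices are joined by a geodesic whose internal vertices have distinct colours (value $0$ for complete graphs). $strc(G)$ is the minimum number of colours in a total-colouring (vertices and edges) in which any two vertices are joined by a geodesic whose edges and internal vertices all have pairwise distinct colours. -}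

module Defs where

open import Data.Nat using (ℕ; zero; suc; _<_)
open import Data.Fin using (Fin; zero; suc; toℕ; inject₁; fromℕ)
open import Data.Bool using (Bool; true; false; T)
open import Data.Product using (Σ; ∃; _×_; _,_)
open import Data.Sum using (_⊎_)
open import Relation.Nullary using (¬_)
open import Relation.Binary.PropositionalEquality using (_≡_; _≢_)

record Graph (n : ℕ) : Set where
  field
    adj   : Fin n → Fin n → Bool
    sym   : ∀ u v → adj u v ≡ adj v u
    irrefl : ∀ u → adj u u ≡ false

open Graph public

Adj : ∀ {n} → Graph n → Fin n → Fin n → Set
Adj G u v = T (adj G u v)

record Walk {n : ℕ} (G : Graph n) (u v : Fin n) (len : ℕ) : Set where
  field
    vtx   : Fin (suc len) → Fin n
    start : vtx zero ≡ u
    end   : vtx (fromℕ len) ≡ v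
    step  : (i : Fin len) → Adj G (vtx (inject₁ i)) (vtx (suc i))

open Walk public

record Geodesic {n : ℕ} (G : Graph n) (u v : Fin n) : Set where
  field
    len     : ℕ
    walk    : Walk G u v len
    minimal : ∀ m → m < len → ¬ Walk G u v m

open Geodesic public

Connected : ∀ {n} → Graph n → Set
Connected G = ∀ u v → Σ ℕ (λ len → Walk G u v len)

SpanningSubgraph : ∀ {n} → Graph n → Graph n → Set
SpanningSubgraph H G = ∀ u v → Adj H u v → Adj G u v

Complete : ∀ {n} → Graph n → Set
Complete G = ∀ u v → u ≢ v → Adj G u v

Internal : ∀ {len} → Fin (suc len) → Set
Internal {len} i = (0 < toℕ i) × (toℕ i < len)

EdgeColouring : ∀ {n} → Graph n → ℕ → Set
EdgeColouring {n} G k =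
  Σ ((u v : Fin n) → Adj G u v → Fin k) λ c →
    ∀ u v (e : Adj G u v) (e' : Adj G v u) → c u v e ≡ c v u e'

edgeColourAt : ∀ {n k} {G : Graph n} → EdgeColouring G k →
               ∀ {u v len} → (w : Walk G u v len) → Fin len → Fin k
edgeColourAt (c , _) w i = c (vtx w (inject₁ i)) (vtx w (suc i)) (step w i)

EdgesRainbow : ∀ {n k} {G : Graph n} → EdgeColouring G k →
               ∀ {u v} → Geodesic G u v → Set
EdgesRainbow c γ = ∀ i j → edgeColourAt c (walk γ) i ≡ edgeColourAt c (walk γ) j → i ≡ j

VertexColouring : ℕ → ℕ → Set
VertexColouring n k = Fin n → Fin k

InternalRainbow : ∀ {n k} {G : Graph n} → VertexColouring n k →
                  ∀ {u v} → Geodesic G u v → Set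
InternalRainbow cv γ = ∀ i j → Internal {len γ} i → Internal {len γ} j →
  cv (vtx (walk γ) i) ≡ cv (vtx (walk γ) j) → i ≡ j

StrongRainbowEdge : ∀ {n k} (G : Graph n) → EdgeColouring G k → Set
StrongRainbowEdge G c = ∀ u v → Σ (Geodesic G u v) λ γ → EdgesRainbow c γ

StrongRainbowVertex : ∀ {n k} (G : Graph n) → VertexColouring n k → Set
StrongRainbowVertex G cv = ∀ u v → Σ (Geodesic G u v) λ γ → InternalRainbow cv γ

TotalColouring : ∀ {n} → Graph n → ℕ → Set
TotalColouring {n} G k = VertexColouring n k × EdgeColouring G k

TotalRainbow : ∀ {n k} {G : Graph n} → TotalColouring G k →
               ∀ {u v} → Geodesic G u v → Set
TotalRainbow (cv , ce) γ =
  EdgesRainbow ce γ × InternalRainbow cv γ ×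
  (∀ (i : Fin (len γ)) j → Internal {len γ} j →
     edgeColourAt ce (walk γ) i ≢ cv (vtx (walk γ) j))

StrongTotalRainbow : ∀ {n k} (G : Graph n) → TotalColouring G k → Set
StrongTotalRainbow G c = ∀ u v → Σ (Geodesic G u v) λ γ → TotalRainbow c γ

IsLeast : (ℕ → Set) → ℕ → Set
IsLeast P k = P k × (∀ j → j < k → ¬ P j)

IsSrc : ∀ {n} → Graph n → ℕ → Set
IsSrc G = IsLeast (λ k → Σ (EdgeColouring G k) (StrongRainbowEdge G))

-- srvc(G) ≡ k   (convention: 0 for complete graphs)
IsSrvc : ∀ {n} → Graph n → ℕ → Set
IsSrvc {n} G k =
  (Complete G × k ≡ 0) ⊎
  (¬ Complete G × IsLeast (λ j → Σ (VertexColouring n j) (StrongRainbowVertex G)) k)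

IsStrc : ∀ {n} → Graph n → ℕ → Set
IsStrc G = IsLeast (λ k → Σ (TotalColouring G k) (StrongTotalRainbow G))

module Submission where

-- Each exact value k is certified in two halves.
--  * Upper bound: an explicit colouring with k colours under which every pair of vertices
--    is joined by a rainbow geodesic.
--  * Lower bound: k witnesses (edges and/or vertices) such that any two distinct ones occupy
--    different places on every geodesic between some pair u, v.  A strong rainbow colouring
--    makes some u–v geodesic rainbow, so the witnesses get k distinct colours.
-- Both halves are finite statements that are decided by evaluation.

open import Defs hiding (sym)
open import Data.Nat using (ℕ; zero; suc; _<_; _>_; _≤_; _≡ᵇ_; _<?_)
open import Data.Nat.Properties using (<-cmp; <⇒≱; m<1+n⇒m<n∨m≡n; n<1+n)
open import Data.Fin using (Fin; zero; suc; toℕ; inject₁; #_)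
open import Data.Fin.Properties using (all?; any?; _≟_; injective⇒≤)
open import Data.Bool using (Bool; false; _∧_; _∨_; if_then_else_)
open import Data.Bool.Properties using (∨-comm; T-irrelevant) renaming (_≟_ to _≟ᴮ_)
open import Data.List using (List; []; _∷_; map; concatMap; allFin)
open import Data.List.Membership.Propositional.Properties using (∈-allFin)
open import Data.List.Relation.Unary.Any as Any using (Any; here; satisfied)
open import Data.List.Relation.Unary.Any.Properties using (concatMap⁺; map⁺)
open import Data.List.Relation.Unary.All as All using (All; lookupAny)
open import Data.Vec using (Vec; lookup; []; _∷_)
open import Data.Maybe using (Maybe; just; nothing)
open import Data.Product using (Σ; ∃₂; _×_; _,_; proj₁; proj₂)
open import Data.Sum using (_⊎_; inj₁; inj₂; [_,_]) renaming (map to ⊎-map)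
open import Data.Empty using (⊥; ⊥-elim)
open import Data.Unit using (⊤; tt)
open import Relation.Binary using (tri<; tri≈; tri>)
open import Relation.Binary.PropositionalEquality using (_≡_; _≢_; refl; sym; trans; cong; cong₂; subst)
open import Relation.Nullary using (¬_; Dec; yes; no)
open import Relation.Nullary.Decidable using (True; toWitness; map′; _×-dec_; _⊎-dec_; _→-dec_; ¬?; T?)

module Walks {n : ℕ} (G : Graph n) where

  stay : ∀ u → Walk G u u 0
  stay u = record { vtx = λ _ → u ; start = refl ; end = refl ; step = λ () }

  _◅_ : ∀ {u w v m} → Adj G u w → Walk G w v m → Walk G u v (suc m)
  _◅_ {u} a p = record
    { vtx   = λ { zero → u ; (suc i) → vtx p i }
    ; start = refl
    ; end   = end p
    ; step  = λ { zero → subst (Adj G u) (sym (start p)) a ; (suc i) → step p i } }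

  firstStep : ∀ {u v m} (p : Walk G u v (suc m)) → Adj G u (vtx p (suc zero))
  firstStep p = subst (λ x → Adj G x (vtx p (suc zero))) (start p) (step p zero)

  rest : ∀ {u v m} (p : Walk G u v (suc m)) → Walk G (vtx p (suc zero)) v m
  rest p = record { vtx = λ i → vtx p (suc i) ; start = refl ; end = end p ; step = λ i → step p (suc i) }

  _≈_ : ∀ {u v m} → Walk G u v m → Walk G u v m → Set
  p ≈ q = ∀ i → vtx p i ≡ vtx q i

  extend : ∀ {u w v m} → Dec (Adj G u w) → List (Walk G w v m) → List (Walk G u v (suc m))
  extend (yes a) ps = map (a ◅_) ps
  extend (no _)  _  = []

  walks : ∀ m u v → List (Walk G u v m)
  walks zero u v with u ≟ v
  ... | yes refl = stay u ∷ []
  ... | no _     = []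
  walks (suc m) u v = concatMap (λ w → extend (T? (adj G u w)) (walks m w v)) (allFin n)

  walks-complete : ∀ {m u v} (p : Walk G u v m) → Any (_≈ p) (walks m u v)
  walks-complete {zero} {u} {v} p with u ≟ v
  ... | yes refl = here λ { zero → sym (start p) }
  ... | no u≢v   = ⊥-elim (u≢v (trans (sym (start p)) (end p)))
  walks-complete {suc m} {u} {v} p =
    concatMap⁺ _ (Any.map (λ { refl → viaSecond (T? (adj G u x)) }) (∈-allFin x))
    where
    x = vtx p (suc zero)
    viaSecond : (a? : Dec (Adj G u x)) → Any (_≈ p) (extend a? (walks m x v))
    viaSecond (yes a) = map⁺ (Any.map (λ q≈ → λ { zero → sym (start p) ; (suc i) → q≈ i })
                                      (walks-complete (rest p)))
    viaSecond (no ¬a) = ⊥-elim (¬a (firstStep p))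

  walk? : ∀ m u v → Dec (Walk G u v m)
  walk? m u v = map′ (λ some → proj₁ (satisfied some))
                     (λ p → Any.map (λ _ → tt) (walks-complete p))
                     (Any.any? (λ _ → yes tt) (walks m u v))

  -- Trying the lengths m, m+1, … in turn: the first length carrying a walk is the distance.
  searchFrom : (fuel m : ℕ) {u v : Fin n} → (∀ k → k < m → ¬ Walk G u v k) → Maybe (Geodesic G u v)
  searchFrom zero       _          _    = nothing
  searchFrom (suc fuel) m {u} {v} none with walk? m u v
  ... | yes p = just (record { len = m ; walk = p ; minimal = none })
  ... | no ¬p = searchFrom fuel (suc m) λ k k<1+m →
                  [ none k , (λ { refl → ¬p }) ] (m<1+n⇒m<n∨m≡n k<1+m)

  -- A u–v geodesic, found among the lengths below n; every distance is below n.
  aGeodesic : ∀ u v → Maybe (Geodesic G u v)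
  aGeodesic u v = searchFrom n 0 (λ _ ())

  geodesic-len : ∀ {u v} (γ δ : Geodesic G u v) → len γ ≡ len δ
  geodesic-len γ δ with <-cmp (len γ) (len δ)
  ... | tri< γ<δ _ _ = ⊥-elim (minimal δ _ γ<δ (walk γ))
  ... | tri≈ _ γ≡δ _ = γ≡δ
  ... | tri> _ _ δ<γ = ⊥-elim (minimal γ _ δ<γ (walk δ))

  module _ {u v : Fin n} where

    along : (γ : Geodesic G u v) → Walk G u v (len γ) → Geodesic G u v
    along γ p = record { len = len γ ; walk = p ; minimal = minimal γ }

    -- Checkable form of "some u–v geodesic satisfies P": one of the walks of length d(u,v) does.
    SomeGeodesic : (Geodesic G u v → Set) → Maybe (Geodesic G u v) → Set
    SomeGeodesic P nothing  = ⊥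
    SomeGeodesic P (just γ) = Any (λ p → P (along γ p)) (walks (len γ) u v)

    someGeodesic? : {P : Geodesic G u v → Set} → (∀ γ → Dec (P γ)) →
                    ∀ mγ → Dec (SomeGeodesic P mγ)
    someGeodesic? P? nothing  = no λ ()
    someGeodesic? P? (just γ) = Any.any? (λ p → P? (along γ p)) (walks (len γ) u v)

    someGeodesic-sound : {P : Geodesic G u v → Set} →
                         ∀ mγ → SomeGeodesic P mγ → Σ (Geodesic G u v) P
    someGeodesic-sound (just γ) some = along γ (proj₁ (satisfied some)) , proj₂ (satisfied some)

    -- Checkable form of "every u–v geodesic satisfies Q": all walks of length d(u,v) do.
    EveryGeodesic : (∀ {m} → Walk G u v m → Set) → Maybe (Geodesic G u v) → Set
    EveryGeodesic Q nothing  = ⊥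
    EveryGeodesic Q (just γ) = All Q (walks (len γ) u v)

    everyGeodesic? : {Q : ∀ {m} → Walk G u v m → Set} → (∀ {m} (p : Walk G u v m) → Dec (Q p)) →
                     ∀ mγ → Dec (EveryGeodesic Q mγ)
    everyGeodesic? Q? nothing  = no λ ()
    everyGeodesic? Q? (just γ) = All.all? Q? (walks (len γ) u v)

    -- Sound for properties that depend only on the vertex sequence, by completeness of `walks`.
    everyGeodesic-sound : {Q : ∀ {m} → Walk G u v m → Set} →
                          (∀ {m} (p q : Walk G u v m) → p ≈ q → Q p → Q q) →
                          ∀ mγ → EveryGeodesic Q mγ → (δ : Geodesic G u v) → Q (walk δ)
    everyGeodesic-sound {Q} resp (just γ) all δ = transfer (walk δ) (geodesic-len δ γ)
      where
      transfer : ∀ {l} (p : Walk G u v l) → l ≡ len γ → Q p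
      transfer p refl = let Qq , q≈p = lookupAny all (walks-complete p) in resp _ _ q≈p Qq

  AllPairs : (∀ {u v} → Geodesic G u v → Set) → Set
  AllPairs P = ∀ u v → SomeGeodesic P (aGeodesic u v)

  allPairs? : {P : ∀ {u v} → Geodesic G u v → Set} →
              (∀ {u v} (γ : Geodesic G u v) → Dec (P γ)) → Dec (AllPairs P)
  allPairs? P? = all? λ u → all? λ v → someGeodesic? P? (aGeodesic u v)

  allPairs-sound : {P : ∀ {u v} → Geodesic G u v → Set} →
                   AllPairs P → ∀ u v → Σ (Geodesic G u v) P
  allPairs-sound all u v = someGeodesic-sound (aGeodesic u v) (all u v)

  connected : {P : ∀ {u v} → Geodesic G u v → Set} → (∀ u v → Σ (Geodesic G u v) P) → Connected G
  connected geo u v = len (proj₁ (geo u v)) , walk (proj₁ (geo u v))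

  HeldApart : {W : Set} → (∀ {u v m} → Walk G u v m → W → W → Set) → ∀ {k} → (Fin k → W) → Set
  HeldApart Apart ws = ∀ a b → a ≢ b →
    ∃₂ λ u v → (γ : Geodesic G u v) → Apart (walk γ) (ws a) (ws b)

  Separated : {W : Set} → (∀ {u v m} → Walk G u v m → W → W → Set) → ∀ {k} → (Fin k → W) → Set
  Separated Apart ws = ∀ a b → a ≢ b →
    ∃₂ λ u v → EveryGeodesic (λ p → Apart p (ws a) (ws b)) (aGeodesic u v)

  separated? : {W : Set} {Apart : ∀ {u v m} → Walk G u v m → W → W → Set} →
               (∀ {u v m} (p : Walk G u v m) x y → Dec (Apart p x y)) →
               ∀ {k} (ws : Fin k → W) → Dec (Separated Apart ws)
  separated? Apart? ws = all? λ a → all? λ b → ¬? (a ≟ b) →-dec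
    any? λ u → any? λ v → everyGeodesic? (λ p → Apart? p (ws a) (ws b)) (aGeodesic u v)

  separated-sound : {W : Set} {Apart : ∀ {u v m} → Walk G u v m → W → W → Set} →
                    (∀ {u v m} (p q : Walk G u v m) → p ≈ q → ∀ {x y} →
                       Apart p x y → Apart q x y) →
                    ∀ {k} {ws : Fin k → W} → Separated Apart ws → HeldApart Apart ws
  separated-sound resp sep a b a≢b =
    let u , v , every = sep a b a≢b in
    u , v , everyGeodesic-sound (λ p q p≈q → resp p q p≈q) (aGeodesic u v) every

open Walks

internal? : ∀ {l} (i : Fin (suc l)) → Dec (Internal {l} i)
internal? {l} i = (0 <? toℕ i) ×-dec (toℕ i <? l)

module RainbowDecisions {n k : ℕ} {G : Graph n} where

  edgesRainbow? : (c : EdgeColouring G k) → ∀ {u v} (γ : Geodesic G u v) → Dec (EdgesRainbow c γ)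
  edgesRainbow? c γ = all? λ i → all? λ j →
    (edgeColourAt c (walk γ) i ≟ edgeColourAt c (walk γ) j) →-dec (i ≟ j)

  internalRainbow? : (cv : VertexColouring n k) → ∀ {u v} (γ : Geodesic G u v) →
                     Dec (InternalRainbow cv γ)
  internalRainbow? cv γ = all? λ i → all? λ j → internal? i →-dec internal? j →-dec
    (cv (vtx (walk γ) i) ≟ cv (vtx (walk γ) j)) →-dec (i ≟ j)

  totalRainbow? : (c : TotalColouring G k) → ∀ {u v} (γ : Geodesic G u v) → Dec (TotalRainbow c γ)
  totalRainbow? (cv , ce) γ = edgesRainbow? ce γ ×-dec internalRainbow? cv γ ×-dec
    (all? λ i → all? λ j → internal? j →-dec ¬? (edgeColourAt ce (walk γ) i ≟ cv (vtx (walk γ) j)))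

open RainbowDecisions

-- Witnesses for the lower bounds: edges (as vertex pairs), vertices, or either.
data Element (n : ℕ) : Set where
  edge   : Fin n × Fin n → Element n
  vertex : Fin n → Element n

module Witnesses {n : ℕ} (G : Graph n) where

  EdgeAt : ∀ {u v m} → Walk G u v m → Fin m → Fin n × Fin n → Set
  EdgeAt p i e = (vtx p (inject₁ i) ≡ proj₁ e × vtx p (suc i) ≡ proj₂ e)
               ⊎ (vtx p (inject₁ i) ≡ proj₂ e × vtx p (suc i) ≡ proj₁ e)

  InternalAt : ∀ {u v m} → Walk G u v m → Fin (suc m) → Fin n → Set
  InternalAt {m = m} p i x = Internal {m} i × vtx p i ≡ x

  -- The pairs of witnesses that a rainbow geodesic p is forced to colour differently.
  EdgesApart : ∀ {u v m} → Walk G u v m → Fin n × Fin n → Fin n × Fin n → Set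
  EdgesApart p e f = ∃₂ λ i j → i ≢ j × EdgeAt p i e × EdgeAt p j f

  VerticesApart : ∀ {u v m} → Walk G u v m → Fin n → Fin n → Set
  VerticesApart p x y = ∃₂ λ i j → i ≢ j × InternalAt p i x × InternalAt p j y

  EdgeAndVertex : ∀ {u v m} → Walk G u v m → Fin n × Fin n → Fin n → Set
  EdgeAndVertex p e x = ∃₂ λ i j → EdgeAt p i e × InternalAt p j x

  ElementsApart : ∀ {u v m} → Walk G u v m → Element n → Element n → Set
  ElementsApart p (edge e)   (edge f)   = EdgesApart p e f
  ElementsApart p (vertex x) (vertex y) = VerticesApart p x y
  ElementsApart p (edge e)   (vertex x) = EdgeAndVertex p e x
  ElementsApart p (vertex x) (edge e)   = EdgeAndVertex p e x

  module _ {u v m} (p q : Walk G u v m) (p≈q : _≈_ G p q) where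

    EdgeAt-≈ : ∀ {i e} → EdgeAt p i e → EdgeAt q i e
    EdgeAt-≈ {i} = ⊎-map moveEnds moveEnds
      where
      moveEnds : ∀ {x y} → vtx p (inject₁ i) ≡ x × vtx p (suc i) ≡ y →
                 vtx q (inject₁ i) ≡ x × vtx q (suc i) ≡ y
      moveEnds (s , t) = trans (sym (p≈q (inject₁ i))) s , trans (sym (p≈q (suc i))) t

    InternalAt-≈ : ∀ {i x} → InternalAt p i x → InternalAt q i x
    InternalAt-≈ {i} (int , s) = int , trans (sym (p≈q i)) s

    EdgesApart-≈ : ∀ {e f} → EdgesApart p e f → EdgesApart q e f
    EdgesApart-≈ (i , j , i≢j , ei , fj) = i , j , i≢j , EdgeAt-≈ ei , EdgeAt-≈ fj

    VerticesApart-≈ : ∀ {x y} → VerticesApart p x y → VerticesApart q x y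
    VerticesApart-≈ (i , j , i≢j , xi , yj) = i , j , i≢j , InternalAt-≈ xi , InternalAt-≈ yj

    EdgeAndVertex-≈ : ∀ {e x} → EdgeAndVertex p e x → EdgeAndVertex q e x
    EdgeAndVertex-≈ (i , j , ei , xj) = i , j , EdgeAt-≈ ei , InternalAt-≈ xj

    ElementsApart-≈ : ∀ {s t} → ElementsApart p s t → ElementsApart q s t
    ElementsApart-≈ {edge _}   {edge _}   = EdgesApart-≈
    ElementsApart-≈ {vertex _} {vertex _} = VerticesApart-≈
    ElementsApart-≈ {edge _}   {vertex _} = EdgeAndVertex-≈
    ElementsApart-≈ {vertex _} {edge _}   = EdgeAndVertex-≈

  edgeAt? : ∀ {u v m} (p : Walk G u v m) i e → Dec (EdgeAt p i e)
  edgeAt? p i (x , y) = ((vtx p (inject₁ i) ≟ x) ×-dec (vtx p (suc i) ≟ y))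
                 ⊎-dec ((vtx p (inject₁ i) ≟ y) ×-dec (vtx p (suc i) ≟ x))

  internalAt? : ∀ {u v m} (p : Walk G u v m) i x → Dec (InternalAt p i x)
  internalAt? p i x = internal? i ×-dec (vtx p i ≟ x)

  edgesApart? : ∀ {u v m} (p : Walk G u v m) e f → Dec (EdgesApart p e f)
  edgesApart? p e f = any? λ i → any? λ j → ¬? (i ≟ j) ×-dec edgeAt? p i e ×-dec edgeAt? p j f

  verticesApart? : ∀ {u v m} (p : Walk G u v m) x y → Dec (VerticesApart p x y)
  verticesApart? p x y = any? λ i → any? λ j →
    ¬? (i ≟ j) ×-dec internalAt? p i x ×-dec internalAt? p j y

  edgeAndVertex? : ∀ {u v m} (p : Walk G u v m) e x → Dec (EdgeAndVertex p e x)
  edgeAndVertex? p e x = any? λ i → any? λ j → edgeAt? p i e ×-dec internalAt? p j x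

  elementsApart? : ∀ {u v m} (p : Walk G u v m) s t → Dec (ElementsApart p s t)
  elementsApart? p (edge e)   (edge f)   = edgesApart? p e f
  elementsApart? p (vertex x) (vertex y) = verticesApart? p x y
  elementsApart? p (edge e)   (vertex x) = edgeAndVertex? p e x
  elementsApart? p (vertex x) (edge e)   = edgeAndVertex? p e x

  IsElement : Element n → Set
  IsElement (edge (x , y)) = Adj G x y
  IsElement (vertex _)     = ⊤

  isElement? : ∀ s → Dec (IsElement s)
  isElement? (edge (x , y)) = T? (adj G x y)
  isElement? (vertex _)     = yes tt

  module _ {k : ℕ} where

    colour-EdgeAt : (c : EdgeColouring G k) → ∀ {u v m} (p : Walk G u v m) i {x y} (a : Adj G x y) →
                    EdgeAt p i (x , y) → edgeColourAt c p i ≡ proj₁ c x y a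
    colour-EdgeAt (c , _)     _ _ a (inj₁ (refl , refl)) = cong (c _ _) (T-irrelevant _ a)
    colour-EdgeAt (_ , c-sym) _ _ a (inj₂ (refl , refl)) = c-sym _ _ _ a

    edges-distinct : (c : EdgeColouring G k) → ∀ {u v} (γ : Geodesic G u v) → EdgesRainbow c γ →
                     ∀ {x y x′ y′} (a : Adj G x y) (a′ : Adj G x′ y′) →
                     EdgesApart (walk γ) (x , y) (x′ , y′) → proj₁ c x y a ≢ proj₁ c x′ y′ a′
    edges-distinct c γ rainbow a a′ (i , j , i≢j , ei , ej) same =
      i≢j (rainbow i j (trans (colour-EdgeAt c (walk γ) i a ei)
                       (trans same (sym (colour-EdgeAt c (walk γ) j a′ ej)))))

    vertices-distinct : (cv : VertexColouring n k) → ∀ {u v} (γ : Geodesic G u v) →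
                        InternalRainbow cv γ → ∀ {x y} → VerticesApart (walk γ) x y → cv x ≢ cv y
    vertices-distinct cv γ rainbow (i , j , i≢j , (ii , refl) , (ij , refl)) same =
      i≢j (rainbow i j ii ij same)

    edge-vertex-distinct : ((cv , ce) : TotalColouring G k) → ∀ {u v} (γ : Geodesic G u v) →
                           TotalRainbow (cv , ce) γ → ∀ {x y z} (a : Adj G x y) →
                           EdgeAndVertex (walk γ) (x , y) z → proj₁ ce x y a ≢ cv z
    edge-vertex-distinct (cv , ce) γ (_ , _ , cross) a (i , j , ei , (ij , refl)) same =
      cross i j ij (trans (colour-EdgeAt ce (walk γ) i a ei) same)

    elementColour : TotalColouring G k → ∀ s → IsElement s → Fin k
    elementColour (_ , ce) (edge (x , y)) a = proj₁ ce x y a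
    elementColour (cv , _) (vertex x)     _ = cv x

    elements-distinct : (c : TotalColouring G k) → ∀ {u v} (γ : Geodesic G u v) → TotalRainbow c γ →
                        ∀ {s t} (is : IsElement s) (it : IsElement t) →
                        ElementsApart (walk γ) s t → elementColour c s is ≢ elementColour c t it
    elements-distinct (_ , ce) γ (re , _) {edge _} {edge _} a a′ apart = edges-distinct ce γ re a a′ apart
    elements-distinct (cv , _) γ (_ , rv , _) {vertex _} {vertex _} _ _ apart =
      vertices-distinct cv γ rv apart
    elements-distinct c γ r {edge _} {vertex _} a _ apart = edge-vertex-distinct c γ r a apart
    elements-distinct c γ r {vertex _} {edge _} _ a apart same =
      edge-vertex-distinct c γ r a apart (sym same)

open Witnesses

distinct⇒≤ : ∀ {k j} (f : Fin k → Fin j) → (∀ a b → a ≢ b → f a ≢ f b) → k ≤ j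
distinct⇒≤ f distinct = injective⇒≤ injective
  where
  injective : ∀ {a b} → f a ≡ f b → a ≡ b
  injective {a} {b} same with a ≟ b
  ... | yes a≡b = a≡b
  ... | no  a≢b = ⊥-elim (distinct a b a≢b same)

least : ∀ {P : ℕ → Set} {k} → P k → (∀ {j} → P j → k ≤ j) → IsLeast P k
least Pk lower = Pk , λ j j<k Pj → <⇒≱ j<k (lower Pj)

module LowerBounds {n : ℕ} (G : Graph n) {k : ℕ} where

  src-lower : (ws : Fin k → Fin n × Fin n) (valid : ∀ a → Adj G (proj₁ (ws a)) (proj₂ (ws a))) →
              HeldApart G (EdgesApart G) ws →
              ∀ {j} → Σ (EdgeColouring G j) (StrongRainbowEdge G) → k ≤ j
  src-lower ws valid forced (c , strong) = distinct⇒≤ (λ a → proj₁ c _ _ (valid a)) λ a b a≢b →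
    let u , v , apart = forced a b a≢b ; γ , rainbow = strong u v in
    edges-distinct G c γ rainbow (valid a) (valid b) (apart γ)

  srvc-lower : (ws : Fin k → Fin n) →
               HeldApart G (VerticesApart G) ws →
               ∀ {j} → Σ (VertexColouring n j) (StrongRainbowVertex G) → k ≤ j
  srvc-lower ws forced (cv , strong) = distinct⇒≤ (λ a → cv (ws a)) λ a b a≢b →
    let u , v , apart = forced a b a≢b ; γ , rainbow = strong u v in
    vertices-distinct G cv γ rainbow (apart γ)

  strc-lower : (ws : Fin k → Element n) (valid : ∀ a → IsElement G (ws a)) →
               HeldApart G (ElementsApart G) ws →
               ∀ {j} → Σ (TotalColouring G j) (StrongTotalRainbow G) → k ≤ j
  strc-lower ws valid forced (c , strong) =
    distinct⇒≤ (λ a → elementColour G c (ws a) (valid a)) λ a b a≢b →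
    let u , v , apart = forced a b a≢b ; γ , rainbow = strong u v in
    elements-distinct G c γ rainbow (valid a) (valid b) (apart γ)

open LowerBounds

module ExactValues {n k : ℕ} (G : Graph n) where

  src-exact : (c : EdgeColouring G k) (ws : Vec (Fin n × Fin n) k) →
              {True (allPairs? G (edgesRainbow? c))} →
              {True (all? λ a → T? (adj G (proj₁ (lookup ws a)) (proj₂ (lookup ws a))))} →
              {True (separated? G (edgesApart? G) (lookup ws))} →
              IsSrc G k
  src-exact c ws {rainbow} {valid} {sep} =
    least (c , allPairs-sound G (toWitness rainbow))
          (src-lower G (lookup ws) (toWitness valid) (separated-sound G (EdgesApart-≈ G) (toWitness sep)))

  -- For srvc also the non-completeness of G is checked: two distinct non-adjacent vertices.
  srvc-exact : (cv : VertexColouring n k) (ws : Vec (Fin n) k) →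
               {True (any? λ x → any? λ y → ¬? (x ≟ y) ×-dec ¬? (T? (adj G x y)))} →
               {True (allPairs? G (internalRainbow? cv))} →
               {True (separated? G (verticesApart? G) (lookup ws))} →
               IsSrvc G k
  srvc-exact cv ws {nonadjacent} {rainbow} {sep} = inj₂
    ( (λ complete → let x , y , x≢y , ¬xy = toWitness nonadjacent in ¬xy (complete x y x≢y))
    , least (cv , allPairs-sound G (toWitness rainbow))
            (srvc-lower G (lookup ws) (separated-sound G (VerticesApart-≈ G) (toWitness sep))) )

  strc-exact : (c : TotalColouring G k) (ws : Vec (Element n) k) →
               {True (allPairs? G (totalRainbow? c))} →
               {True (all? λ a → isElement? G (lookup ws a))} →
               {True (separated? G (elementsApart? G) (lookup ws))} →
               IsStrc G k
  strc-exact c ws {rainbow} {valid} {sep} =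
    least (c , allPairs-sound G (toWitness rainbow))
          (strc-lower G (lookup ws) (toWitness valid) (separated-sound G (ElementsApart-≈ G) (toWitness sep)))

open ExactValues

joins : ℕ × ℕ → ℕ → ℕ → Bool
joins (a , b) x y = ((a ≡ᵇ x) ∧ (b ≡ᵇ y)) ∨ ((a ≡ᵇ y) ∧ (b ≡ᵇ x))

joins-sym : ∀ e x y → joins e x y ≡ joins e y x
joins-sym (a , b) x y = ∨-comm ((a ≡ᵇ x) ∧ (b ≡ᵇ y)) ((a ≡ᵇ y) ∧ (b ≡ᵇ x))

adjacency : List (ℕ × ℕ) → ℕ → ℕ → Bool
adjacency []       x y = false
adjacency (e ∷ es) x y = joins e x y ∨ adjacency es x y

adjacency-sym : ∀ es x y → adjacency es x y ≡ adjacency es y x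
adjacency-sym []       x y = refl
adjacency-sym (e ∷ es) x y = cong₂ _∨_ (joins-sym e x y) (adjacency-sym es x y)

graph : ∀ n (es : List (ℕ × ℕ)) →
        {True (all? λ (u : Fin n) → adjacency es (toℕ u) (toℕ u) ≟ᴮ false)} → Graph n
graph n es {loopless} = record
  { adj    = λ u v → adjacency es (toℕ u) (toℕ v)
  ; sym    = λ u v → adjacency-sym es (toℕ u) (toℕ v)
  ; irrefl = toWitness loopless }

-- Edge colourings given as lists of coloured edges (non-edges get colour 0, never used).
edgesOf : ∀ {k} → List (ℕ × ℕ × Fin k) → List (ℕ × ℕ)
edgesOf = map λ (a , b , _) → a , b

colourIn : ∀ {k} → List (ℕ × ℕ × Fin (suc k)) → ℕ → ℕ → Fin (suc k)
colourIn []                 x y = zero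
colourIn ((a , b , c) ∷ es) x y = if joins (a , b) x y then c else colourIn es x y

colourIn-sym : ∀ {k} (es : List (ℕ × ℕ × Fin (suc k))) x y → colourIn es x y ≡ colourIn es y x
colourIn-sym []                 x y = refl
colourIn-sym ((a , b , c) ∷ es) x y =
  cong₂ (if_then c else_) (joins-sym (a , b) x y) (colourIn-sym es x y)

edgeColouring : ∀ {n k} (G : Graph n) → List (ℕ × ℕ × Fin (suc k)) → EdgeColouring G (suc k)
edgeColouring G es =
  (λ u v _ → colourIn es (toℕ u) (toℕ v)) , λ u v _ _ → colourIn-sym es (toℕ u) (toℕ v)

connected-by-evaluation : ∀ {n} (G : Graph n) → {True (allPairs? G (λ _ → yes tt))} → Connected G
connected-by-evaluation G {reach} = connected G (allPairs-sound G (toWitness reach))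

spanning-by-evaluation : ∀ {n} (G H : Graph n) →
                         {True (all? λ u → all? λ v → T? (adj H u v) →-dec T? (adj G u v))} →
                         SpanningSubgraph H G
spanning-by-evaluation G H {sub} = toWitness sub

Drop : (∀ {n} → Graph n → ℕ → Set) → Set
Drop Inv = Σ ℕ λ n → Σ (Graph n) λ G → Σ (Graph n) λ H →
  Connected G × Connected H × SpanningSubgraph H G ×
  Σ ℕ λ a → Σ ℕ λ b → Inv G a × Inv H b × a > b

-- src: a vertex 0 joined to 1,…,5 and the path 3–2–6–4–7; H omits the edge 0–3.
srcG-colouring : List (ℕ × ℕ × Fin 5)
srcG-colouring =
  (0 , 1 , # 1) ∷ (0 , 2 , # 0) ∷ (0 , 3 , # 4) ∷ (0 , 4 , # 0) ∷ (0 , 5 , # 2) ∷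
  (2 , 3 , # 1) ∷ (2 , 6 , # 0) ∷ (4 , 6 , # 4) ∷ (4 , 7 , # 3) ∷ []

srcH-colouring : List (ℕ × ℕ × Fin 4)
srcH-colouring =
  (0 , 1 , # 2) ∷ (0 , 2 , # 0) ∷ (0 , 4 , # 1) ∷ (0 , 5 , # 3) ∷
  (2 , 3 , # 1) ∷ (2 , 6 , # 2) ∷ (4 , 6 , # 3) ∷ (4 , 7 , # 0) ∷ []

srcG srcH : Graph 8
srcG = graph 8 (edgesOf srcG-colouring)
srcH = graph 8 (edgesOf srcH-colouring)

src-drop : Drop IsSrc
src-drop = 8 , srcG , srcH , connected-by-evaluation srcG , connected-by-evaluation srcH ,
  spanning-by-evaluation srcG srcH , 5 , 4 ,
  src-exact srcG (edgeColouring srcG srcG-colouring)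
    ((# 0 , # 3) ∷ (# 0 , # 4) ∷ (# 0 , # 1) ∷ (# 0 , # 5) ∷ (# 4 , # 7) ∷ []) ,
  src-exact srcH (edgeColouring srcH srcH-colouring)
    ((# 4 , # 7) ∷ (# 0 , # 4) ∷ (# 0 , # 1) ∷ (# 0 , # 5) ∷ []) ,
  n<1+n 4

-- srvc: H omits the edge 2–7 of G.
srvcG srvcH : Graph 9
srvcG = graph 9 ((0 , 1) ∷ (0 , 5) ∷ (1 , 2) ∷ (1 , 4) ∷ (1 , 7) ∷ (2 , 3) ∷
                 (2 , 6) ∷ (2 , 7) ∷ (3 , 4) ∷ (3 , 6) ∷ (4 , 7) ∷ (7 , 8) ∷ [])
srvcH = graph 9 ((0 , 1) ∷ (0 , 5) ∷ (1 , 2) ∷ (1 , 4) ∷ (1 , 7) ∷ (2 , 3) ∷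
                 (2 , 6) ∷ (3 , 4) ∷ (3 , 6) ∷ (4 , 7) ∷ (7 , 8) ∷ [])

srvc-drop : Drop IsSrvc
srvc-drop = 9 , srvcG , srvcH , connected-by-evaluation srvcG , connected-by-evaluation srvcH ,
  spanning-by-evaluation srvcG srvcH , 4 , 3 ,
  srvc-exact srvcG (lookup (# 3 ∷ # 0 ∷ # 1 ∷ # 0 ∷ # 0 ∷ # 0 ∷ # 0 ∷ # 2 ∷ # 0 ∷ []))
    (# 2 ∷ # 7 ∷ # 0 ∷ # 1 ∷ []) ,
  srvc-exact srvcH (lookup (# 1 ∷ # 0 ∷ # 2 ∷ # 1 ∷ # 0 ∷ # 0 ∷ # 0 ∷ # 2 ∷ # 0 ∷ []))
    (# 2 ∷ # 0 ∷ # 1 ∷ []) ,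
  n<1+n 3

-- strc: a vertex 0 joined to all others, plus edges among 1,2,5,…,9; H omits the edge 0–5.
strcG-colouring : List (ℕ × ℕ × Fin 6)
strcG-colouring =
  (0 , 1 , # 3) ∷ (0 , 2 , # 4) ∷ (0 , 3 , # 1) ∷ (0 , 4 , # 2) ∷ (0 , 5 , # 5) ∷ (0 , 6 , # 4) ∷
  (0 , 7 , # 3) ∷ (0 , 8 , # 3) ∷ (0 , 9 , # 3) ∷ (1 , 7 , # 1) ∷ (2 , 9 , # 1) ∷ (5 , 6 , # 0) ∷
  (5 , 8 , # 0) ∷ (6 , 8 , # 1) ∷ (6 , 9 , # 0) ∷ (7 , 8 , # 0) ∷ (7 , 9 , # 0) ∷ []

strcH-colouring : List (ℕ × ℕ × Fin 5)
strcH-colouring =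
  (0 , 1 , # 2) ∷ (0 , 2 , # 1) ∷ (0 , 3 , # 3) ∷ (0 , 4 , # 4) ∷ (0 , 6 , # 1) ∷
  (0 , 7 , # 1) ∷ (0 , 8 , # 2) ∷ (0 , 9 , # 1) ∷ (1 , 7 , # 2) ∷ (2 , 9 , # 1) ∷ (5 , 6 , # 2) ∷
  (5 , 8 , # 1) ∷ (6 , 8 , # 1) ∷ (6 , 9 , # 0) ∷ (7 , 8 , # 0) ∷ (7 , 9 , # 0) ∷ []

strcG strcH : Graph 10
strcG = graph 10 (edgesOf strcG-colouring)
strcH = graph 10 (edgesOf strcH-colouring)

strc-drop : Drop IsStrc
strc-drop = 10 , strcG , strcH , connected-by-evaluation strcG , connected-by-evaluation strcH ,
  spanning-by-evaluation strcG strcH , 6 , 5 ,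
  strc-exact strcG (lookup (# 0 ∷ # 0 ∷ # 0 ∷ # 0 ∷ # 0 ∷ # 0 ∷ # 2 ∷ # 2 ∷ # 0 ∷ # 2 ∷ []) ,
                    edgeColouring strcG strcG-colouring)
    (edge (# 0 , # 2) ∷ edge (# 0 , # 3) ∷ edge (# 0 , # 4) ∷ edge (# 0 , # 5) ∷ edge (# 0 , # 1) ∷
     vertex (# 0) ∷ []) ,
  strc-exact strcH (lookup (# 0 ∷ # 0 ∷ # 0 ∷ # 0 ∷ # 0 ∷ # 0 ∷ # 3 ∷ # 3 ∷ # 4 ∷ # 4 ∷ []) ,
                    edgeColouring strcH strcH-colouring)
    (edge (# 0 , # 2) ∷ edge (# 0 , # 3) ∷ edge (# 0 , # 4) ∷ edge (# 0 , # 1) ∷ vertex (# 0) ∷ []) ,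
  n<1+n 5

lemma2p4 : (Σ ℕ λ n → Σ (Graph n) λ G → Σ (Graph n) λ H →
    Connected G × Connected H × SpanningSubgraph H G ×
    Σ ℕ λ a → Σ ℕ λ b → IsSrc G a × IsSrc H b × a > b)
    × (Σ ℕ λ n → Σ (Graph n) λ G → Σ (Graph n) λ H →
    Connected G × Connected H × SpanningSubgraph H G ×
    Σ ℕ λ a → Σ ℕ λ b → IsSrvc G a × IsSrvc H b × a > b)
    × (Σ ℕ λ n → Σ (Graph n) λ G → Σ (Graph n) λ H →
    Connected G × Connected H × SpanningSubgraph H G ×
    Σ ℕ λ a → Σ ℕ λ b → IsStrc G a × IsStrc H b × a > b)
lemma2p4 = src-drop , srvc-drop , strc-drop
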